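{- For every face $F$ of $\mathcal{P}_\lambda$, the graph $\phi(F)$ contains every terminal vertex of $\Gamma_{\mathbf{k}}$ and the origin $(0,0)$.
   Context: Fix $n>1$, a sequence $\mathbf{k}=(k_1,\dots,k_s)$ of positive integers with $\sum k_i=n$, $n_i=k_1+\dots+k_i$, $n_0=0$, and real $\lambda=(\lambda_1,\dots,\lambda_n)$ with $\lambda_1=\cdots=\lambda_{n_1}>\lambda_{n_1+1}=\cdots=\lambda_{n_2}>\cdots>\lambda_{n_{s-1}+1}=\cdots=\lambda_n$. Let $I=\{(i,j)\in\mathbb{Z}^2:i,j\ge1,\ i+j\le n\}$. $\mathcal{P}_\lambda\subset\mathbb{R}^I$ is the set of $x=(x_{i,j})$ with $x_{i,j+1}\ge x_{i,j}\ge x_{i+1,j}$ for all $(i,j)\in I$, where $x_{i,n+1-i}:=\lambda_i$. Faces of $\mathcal{P}_\lambda$ are its nonempty faces. $Q^+$ is the directed graph on $\mathbb{Z}_{\ge0}^2$ with edges $((i,j),(i,j+1))$, $((i,j),(i+1,j))$. The terminal vertices are $T_{\mathbf{k}}=\{(n_i,n-n_i):0\le i\le s\}$ and $\Gamma_{\mathbf{k}}$ is the induced subgraph of $Q^+$ on $\{(a,b):a\le c,\ b\le d\text{ for some }(c,d)\in T_{\mathbf{k}}\}$. For a face $F$, $\phi(F)$ is the subgraph of $Q^+$ whose edge set consists of: $((0,i),(0,i+1))$ and $((i,0),(i+1,0))$ for $0\le i\le n-1$; $((i-1,j),(i,j))$ for each $(i,j)\in I$ such that some point of $F$ has $x_{i,j}<x_{i,j+1}$;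 $((i,j-1),(i,j))$ for each $(i,j)\in I$ such that some point of $F$ has $x_{i,j}>x_{i+1,j}$; and whose vertex set is the set of endpoints of these edges. -}

module Defs where

open import Level using (0ℓ)
open import Data.Nat as ℕ using (ℕ; zero; suc; _∸_; _≤ᵇ_)
open import Data.Bool using (if_then_else_)
open import Data.List using (List; []; _∷_; map)
open import Data.Nat.ListAction using (sum)
open import Data.List.Membership.Propositional using (_∈_)
open import Data.Product using (Σ; ∃; _×_; _,_)
open import Data.Sum using (_⊎_)
open import Relation.Nullary using (¬_)
open import Relation.Binary.PropositionalEquality using (_≡_)
import Algebra.Structures as AS
import Relation.Binary.Structures as RS

-- An ordered field (the reals ℝ are one; the statement is proved for all of them).
record OrderedField : Set₁ where
  infixl 6 _+_
  infixl 7 _*_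
  infix 4 _<_
  field
    Carrier : Set
    _+_ _*_ : Carrier → Carrier → Carrier
    -_ : Carrier → Carrier
    0# 1# : Carrier
    _<_ : Carrier → Carrier → Set
    isCommutativeRing : AS.IsCommutativeRing _≡_ _+_ _*_ -_ 0# 1#
    isStrictTotalOrder : RS.IsStrictTotalOrder _≡_ _<_
    +-mono-< : ∀ {x y} z → x < y → x + z < y + z
    *-pos : ∀ {x y} → 0# < x → 0# < y → 0# < x * y
    0≢1 : ¬ (0# ≡ 1#)
    inverse : ∀ x → ¬ (x ≡ 0#) → ∃ λ y → x * y ≡ 1#

  _≤_ : Carrier → Carrier → Set
  x ≤ y = x < y ⊎ x ≡ y

module GT (R : OrderedField) where
  open OrderedField R

  Σ< : ℕ → (ℕ → Carrier) → Carrier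
  Σ< zero f = 0#
  Σ< (suc m) f = Σ< m f + f m

  -- points of ℝ^I: only the values on I = {(i,j) : i,j ≥ 1, i+j ≤ n} matter
  Point : Set
  Point = ℕ → ℕ → Carrier

  InI : ℕ → ℕ → ℕ → Set
  InI n i j = (1 ℕ.≤ i) × (1 ℕ.≤ j) × (i ℕ.+ j ℕ.≤ n)

  -- x extended by the convention x_{i,n+1-i} := λ_i
  ext : ℕ → (ℕ → Carrier) → Point → Point
  ext n lam x i j = if (i ℕ.+ j ≤ᵇ n) then x i j else lam i

  InP : ℕ → (ℕ → Carrier) → Point → Set
  InP n lam x = ∀ i j → InI n i j →
    (ext n lam x i (suc j) ≥' x i j) × (x i j ≥' ext n lam x (suc i) j)
    where
    _≥'_ : Carrier → Carrier → Set
    a ≥' b = b ≤ a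

  dot : ℕ → Point → Point → Carrier
  dot n c x = Σ< n λ i → Σ< n λ j →
    if (suc i ℕ.+ suc j ≤ᵇ n) then c (suc i) (suc j) * x (suc i) (suc j) else 0#

  -- F is a (nonempty) face of 𝒫_λ: F = 𝒫_λ ∩ H for a supporting hyperplane
  -- H = {c·x = b} with c·x ≤ b on 𝒫_λ (c = 0 gives 𝒫_λ itself)
  IsFace : ℕ → (ℕ → Carrier) → (Point → Set) → Set
  IsFace n lam F =
    Σ Point λ c → Σ Carrier λ b →
      (∀ x → InP n lam x → dot n c x ≤ b) ×
      (∀ x → F x → InP n lam x × dot n c x ≡ b) ×
      (∀ x → InP n lam x → dot n c x ≡ b → F x) ×
      (∃ λ x → F x)

  data φEdge (n : ℕ) (lam : ℕ → Carrier) (F : Point → Set) : ℕ × ℕ → ℕ × ℕ → Set where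
    top  : ∀ i → i ℕ.< n → φEdge n lam F (0 , i) (0 , suc i)
    left : ∀ i → i ℕ.< n → φEdge n lam F (i , 0) (suc i , 0)
    vert : ∀ i j → InI n i j → (∃ λ x → F x × (x i j < ext n lam x i (suc j))) →
           φEdge n lam F (i ∸ 1 , j) (i , j)
    horz : ∀ i j → InI n i j → (∃ λ x → F x × (ext n lam x (suc i) j < x i j)) →
           φEdge n lam F (i , j ∸ 1) (i , j)

  φVertex : ℕ → (ℕ → Carrier) → (Point → Set) → ℕ × ℕ → Set
  φVertex n lam F v = ∃ λ w → φEdge n lam F v w ⊎ φEdge n lam F w v

partialSums : List ℕ → List ℕ
partialSums [] = 0 ∷ []
partialSums (k ∷ ks) = 0 ∷ map (k ℕ.+_) (partialSums ks)

IsTerminal : ℕ → List ℕ → ℕ × ℕ → Set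
IsTerminal n ks (a , b) = a ∈ partialSums ks × b ≡ n ∸ a

IsComposition : ℕ → List ℕ → Set
IsComposition n ks = (∀ k → k ∈ ks → 1 ℕ.≤ k) × sum ks ≡ n

-- λ_1 = … = λ_{n_1} > λ_{n_1+1} = … > … = λ_n   (λ indexed 1..n)
Adapted : (R : OrderedField) → ℕ → List ℕ → (ℕ → OrderedField.Carrier R) → Set
Adapted R n ks lam = ∀ a → 1 ℕ.≤ a → a ℕ.< n →
  (a ∈ partialSums ks → lam (suc a) < lam a) ×
  (¬ (a ∈ partialSums ks) → lam a ≡ lam (suc a))
  where open OrderedField R

-- The origin and the endpoints (0 , n), (n , 0) lie on the axis edges that φ(F) always contains.
-- At an inner terminal vertex (a , n - a) the two neighbours of x_{a,n-a} on the boundary of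
-- the pattern are the constants λ_a and λ_{a+1}, and λ_{a+1} < λ_a because a is a partial sum.
-- So for any point x of F, x_{a,n-a} < λ_a or λ_{a+1} < x_{a,n-a}: one of the two edges ending
-- at (a , n - a) is in φ(F).
module Submission where

open import Defs
open import Data.Nat using (ℕ; suc; _+_; _∸_; _≤_; _<_; _≤ᵇ_; _≟_; z≤n; s≤s)
open import Data.Nat.Properties
  using (+-monoʳ-≤; +-suc; n<1+n; ≤ᵇ⇒≤; <⇒≱; ≤∧≢⇒<; n≢0⇒n>0; m+[n∸m]≡n; m<n⇒0<n∸m; n∸n≡0; ≤-reflexive)
open import Data.Nat.ListAction using (sum)
open import Data.Bool using (true; false; T)
open import Data.Unit using (tt)
open import Data.List using (List; []; _∷_)
open import Data.List.Relation.Unary.Any using (here; there)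
open import Data.List.Membership.Propositional using (_∈_)
open import Data.List.Membership.Propositional.Properties using (∈-map⁻)
open import Data.Product using (_×_; _,_; proj₁)
open import Data.Sum using (_⊎_; inj₁; inj₂; [_,_]′)
open import Data.Empty using (⊥-elim)
open import Relation.Nullary using (yes; no)
open import Relation.Binary.PropositionalEquality using (_≡_; refl; sym; subst)
open import Relation.Binary.Structures using (IsStrictTotalOrder)
open import Relation.Binary.Definitions using (tri<; tri≈; tri>)

partialSum≤sum : ∀ ks {a} → a ∈ partialSums ks → a ≤ sum ks
partialSum≤sum []       (here refl) = z≤n
partialSum≤sum (k ∷ ks) (here refl) = z≤n
partialSum≤sum (k ∷ ks) (there a∈) with ∈-map⁻ (k +_) a∈
... | b , b∈ , refl = +-monoʳ-≤ k (partialSum≤sum ks b∈)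

module _ (R : OrderedField) where
  open OrderedField R using (Carrier; isStrictTotalOrder) renaming (_<_ to _<ᴿ_)
  open IsStrictTotalOrder isStrictTotalOrder using (compare; trans)
  open GT R

  <-or-< : ∀ {c b} → c <ᴿ b → ∀ x → x <ᴿ b ⊎ c <ᴿ x
  <-or-< c<b x with compare x _
  ... | tri< x<b _ _ = inj₁ x<b
  ... | tri≈ _ refl _ = inj₂ c<b
  ... | tri> _ _ b<x = inj₂ (trans c<b b<x)

  ext-beyond : ∀ n lam x i j → n < i + j → ext n lam x i j ≡ lam i
  ext-beyond n lam x i j n<i+j with i + j ≤ᵇ n in eq
  ... | false = refl
  ... | true = ⊥-elim (<⇒≱ n<i+j (≤ᵇ⇒≤ (i + j) n (subst T (sym eq) tt)))

  module _ {lam : ℕ → Carrier} {F : Point → Set} where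

    φVertex-origin : ∀ {n} → 0 < n → φVertex n lam F (0 , 0)
    φVertex-origin 0<n = (0 , 1) , inj₁ (top 0 0<n)

    φVertex-top-end : ∀ {m} → φVertex (suc m) lam F (0 , suc m)
    φVertex-top-end {m} = (0 , m) , inj₂ (top m (n<1+n m))

    φVertex-left-end : ∀ {m} → φVertex (suc m) lam F (suc m , 0)
    φVertex-left-end {m} = (m , 0) , inj₂ (left m (n<1+n m))

    φVertex-boundary : ∀ {n x} → F x → ∀ a b → 1 ≤ a → 1 ≤ b → a + b ≡ n →
                       lam (suc a) <ᴿ lam a → φVertex n lam F (a , b)
    φVertex-boundary {n} {x} x∈F a b 1≤a 1≤b a+b≡n gap = [ vertical , horizontal ]′ (<-or-< gap (x a b))
      where
      inI : InI n a b
      inI = 1≤a , 1≤b , ≤-reflexive a+b≡n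
      n<1+a+b : n < suc (a + b)
      n<1+a+b = subst (λ m → n < suc m) (sym a+b≡n) (n<1+n n)
      vertical : x a b <ᴿ lam a → φVertex n lam F (a , b)
      vertical x<λa = _ , inj₂ (vert a b inI (x , x∈F , subst (x a b <ᴿ_) (sym right≡λa) x<λa))
        where
        right≡λa : ext n lam x a (suc b) ≡ lam a
        right≡λa = ext-beyond n lam x a (suc b) (subst (n <_) (sym (+-suc a b)) n<1+a+b)
      horizontal : lam (suc a) <ᴿ x a b → φVertex n lam F (a , b)
      horizontal λa+1<x = _ , inj₂ (horz a b inI (x , x∈F , subst (_<ᴿ x a b) (sym below≡λa+1) λa+1<x))
        where
        below≡λa+1 : ext n lam x (suc a) b ≡ lam (suc a)
        below≡λa+1 = ext-beyond n lam x (suc a) b n<1+a+b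

lemma2p2 : (R : OrderedField) (n : ℕ) (ks : List ℕ) (lam : ℕ → OrderedField.Carrier R) →
    1 < n → IsComposition n ks → Adapted R n ks lam →
    (F : GT.Point R → Set) → GT.IsFace R n lam F →
    ((t : ℕ × ℕ) → IsTerminal n ks t → GT.φVertex R n lam F t) ×
    GT.φVertex R n lam F (0 , 0)
lemma2p2 R (suc m) ks lam (s≤s _) (_ , sum≡n) adapted F (_ , _ , _ , _ , _ , x , x∈F) =
  terminal , φVertex-origin R (s≤s z≤n)
  where
  terminal : (t : ℕ × ℕ) → IsTerminal (suc m) ks t → GT.φVertex R (suc m) lam F t
  terminal (a , _) (a∈ , refl) with a ≟ 0 | a ≟ suc m
  ... | yes refl | _ = φVertex-top-end R
  ... | no _ | yes refl rewrite n∸n≡0 m = φVertex-left-end R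
  ... | no a≢0 | no a≢n =
    φVertex-boundary R x∈F a (suc m ∸ a) 1≤a (m<n⇒0<n∸m a<n) (m+[n∸m]≡n a≤n)
      (proj₁ (adapted a 1≤a a<n) a∈)
    where
    a≤n : a ≤ suc m
    a≤n = subst (a ≤_) sum≡n (partialSum≤sum ks a∈)
    a<n : a < suc m
    a<n = ≤∧≢⇒< a≤n a≢n
    1≤a : 1 ≤ a
    1≤a = n≢0⇒n>0 a≢0
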